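{- Let $\mathcal F$ be an intersecting family (any two members intersect) all of whose members are sets of size exactly $3$ (triangles), and let $\mathcal C$ be the simplicial complex generated by $\mathcal F$ (the family of all subsets of members of $\mathcal F$). Suppose that at least one of the following holds: (1) there exist a triangle $T\in\mathcal F$ and a vertex $x\in T$ such that at most one triangle $\tau\in\mathcal F$ satisfies $\tau\cap T=\{x\}$; (2) no two triangles in $\mathcal F$ share two elements; (3) there exist two distinct vertices of $\mathcal C$ (elements of $\bigcup\mathcal F$) that are not both contained in a common member of $\mathcal F$ (i.e. the graph of $\mathcal C$ is not complete). Then there exists an intersecting family $\mathcal F'\subseteq\mathcal C$ with $|\mathcal F'|\ge|\mathcal F|$ that contains a set of size $2$ or of size $1$.
   Context: A simplicial complex is a family of subsets of a finite ground set closed under taking subsets; elements of size $1,2,3$ are called vertices, edges and triangles. The graph of $\mathcal C$ has the vertices of $\mathcal C$ as vertices and the edges of $\mathcal C$ as edges. A triangle $\tau\in\mathcal F$ is said to dangle from $T\in\mathcal F$ at $x\in T$ if $\tau\cap T=\{x\}$. -}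

module Defs where

open import Data.Nat using (ℕ; _≤_)
open import Data.Fin using (Fin)
open import Data.Fin.Subset using (Subset; _∈_; _⊆_; _∩_; ∣_∣; ⁅_⁆; Nonempty)
open import Data.List using (List; length)
import Data.List.Membership.Propositional as LM
open import Data.List.Relation.Unary.Unique.Propositional using (Unique)
open import Data.Product using (Σ; _×_; ∃)
open import Data.Sum using (_⊎_)
open import Relation.Binary.PropositionalEquality using (_≡_; _≢_)
open import Relation.Nullary using (¬_)

-- A finite family of subsets of the ground set Fin n, given as a duplicate-free list.
Family : ℕ → Set
Family n = List (Subset n)

_∈F_ : ∀ {n} → Subset n → Family n → Set
A ∈F F = A LM.∈ F

-- distinct members (no repetitions), so that length = cardinality
IsSetFamily : ∀ {n} → Family n → Set
IsSetFamily F = Unique F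

AllTriangles : ∀ {n} → Family n → Set
AllTriangles F = ∀ T → T ∈F F → ∣ T ∣ ≡ 3

Intersecting : ∀ {n} → Family n → Set
Intersecting F = ∀ A B → A ∈F F → B ∈F F → Nonempty (A ∩ B)

_∈C_ : ∀ {n} → Subset n → Family n → Set
_∈C_ {n} A F = Σ (Subset n) λ T → T ∈F F × A ⊆ T

SubfamilyOfComplex : ∀ {n} → Family n → Family n → Set
SubfamilyOfComplex F' F = ∀ A → A ∈F F' → A ∈C F

DanglesAt : ∀ {n} → Subset n → Subset n → Fin n → Set
DanglesAt τ T x = τ ∩ T ≡ ⁅ x ⁆

Cond1 : ∀ {n} → Family n → Set
Cond1 {n} F = Σ (Subset n) λ T → T ∈F F × Σ (Fin n) λ x → x ∈ T ×
  (∀ τ₁ τ₂ → τ₁ ∈F F → τ₂ ∈F F → DanglesAt τ₁ T x → DanglesAt τ₂ T x → τ₁ ≡ τ₂)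

Cond2 : ∀ {n} → Family n → Set
Cond2 F = ∀ A B → A ∈F F → B ∈F F → 2 ≤ ∣ A ∩ B ∣ → A ≡ B

IsVertex : ∀ {n} → Fin n → Family n → Set
IsVertex {n} x F = Σ (Subset n) λ T → T ∈F F × x ∈ T

Cond3 : ∀ {n} → Family n → Set
Cond3 {n} F = Σ (Fin n) λ x → Σ (Fin n) λ y → x ≢ y × IsVertex x F × IsVertex y F ×
  ¬ (Σ (Subset n) λ T → T ∈F F × x ∈ T × y ∈ T)

-- Call τ a dangler at (T, x) when τ ∩ T = {x}. If some (T, x) has at most one dangler, replace
-- T by the edge T - x and drop the dangler: every other member meets T outside x.
-- Under (2), given a dangler τ at (T, x), each member avoiding x contains a vertex of T - x and one
-- of τ - x; by (2) this pair determines the member, and the four possible pairs can be encoded by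
-- the four edges from x to (T ∪ τ) - x, all in the complex. Sending each member avoiding x to its
-- edge and adding {x} gives an injective image forming a star at x, hence intersecting.
-- Under (3), with x, y in no common member, two danglers at (T, x) and one at (W, y) would make
-- the two danglers share three vertices.

module Submission where

open import Defs
open import Data.Bool using (Bool; true; false; if_then_else_)
open import Data.Empty using (⊥; ⊥-elim)
open import Data.Fin using (Fin; zero; suc)
open import Data.Fin.Properties using (_≟_; any?)
open import Data.Fin.Subset
  using (Subset; _∈_; _∉_; _⊆_; _∩_; _∪_; _-_; ∣_∣; ⁅_⁆; Nonempty; inside; outside)
open import Data.Fin.Subset.Properties
  using (_∈?_; x∈⁅x⁆; x∈⁅y⁆⇒x≡y; ∣⁅x⁆∣≡1; ⊆-antisym; x∈p∩q⁺; x∈p∩q⁻; x∈p∪q⁺; x∈p∪q⁻;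
         x∈p∧x≢y⇒x∈p-y; p─q⊆p; p─⊥≡p)
open import Data.List using (List; []; _∷_; length; filter; map)
open import Data.Vec using (_∷_; here; there)
open import Data.List.Properties using (length-map)
open import Data.List.Membership.Propositional.Properties using (∈-filter⁻; ∈-map⁻)
open import Data.List.Relation.Unary.All using (_∷_; tabulate; lookup)
open import Data.List.Relation.Unary.All.Properties using (map⁺)
open import Data.List.Relation.Unary.AllPairs using ([]; _∷_)
open import Data.List.Relation.Unary.Any using (here; there)
open import Data.List.Relation.Unary.Unique.Propositional using (Unique)
import Data.List.Relation.Unary.Unique.Propositional.Properties as Unique
import Data.List.Membership.Propositional as List
open import Data.Nat using (ℕ; suc; _+_; _≤_; z≤n; s≤s)
open import Data.Nat.Properties using (suc-injective; +-suc; +-monoˡ-≤; ≤-trans; ≤-reflexive; n≤1+n)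
open import Data.Product using (Σ; ∃; ∃₂; _×_; _,_; proj₁; proj₂; uncurry)
open import Data.Sum using (_⊎_; inj₁; inj₂)
import Data.Bool.Properties as Bool
import Data.Vec.Properties as Vec
open import Function using (_∘_)
open import Relation.Nullary using (¬_; Dec; yes; no; does)
open import Relation.Nullary.Decidable using (¬?; _×-dec_; decidable-stable)
open import Relation.Unary using (Pred; Decidable; ∁)
open import Relation.Unary.Properties using (∁?)
open import Relation.Binary.PropositionalEquality using (_≡_; _≢_; refl; sym; trans; cong; subst)

private
  variable
    n k : ℕ
    p q R S T τ : Subset n
    u v w x : Fin n

∈∧∉⇒≢ : u ∈ p → v ∉ p → u ≢ v
∈∧∉⇒≢ u∈p u∉p refl = u∉p u∈p

∈-∩ˡ : u ∈ p ∩ q → u ∈ p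
∈-∩ˡ {p = p} {q} m = proj₁ (x∈p∩q⁻ p q m)

∈-∩ʳ : u ∈ p ∩ q → u ∈ q
∈-∩ʳ {p = p} {q} m = proj₂ (x∈p∩q⁻ p q m)

∈-∩⁺ : u ∈ p → u ∈ q → u ∈ p ∩ q
∈-∩⁺ u∈p u∈q = x∈p∩q⁺ (u∈p , u∈q)

if-injective : ∀ {a} {A : Set a} {l r : A} → l ≢ r →
  ∀ {i j} → (if i then l else r) ≡ (if j then l else r) → i ≡ j
if-injective l≢r {true} {true} _ = refl
if-injective l≢r {true} {false} l≡r = ⊥-elim (l≢r l≡r)
if-injective l≢r {false} {true} r≡l = ⊥-elim (l≢r (sym r≡l))
if-injective l≢r {false} {false} _ = refl

nonempty-of-suc : (p : Subset n) → ∣ p ∣ ≡ suc k → Nonempty p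
nonempty-of-suc (inside ∷ p) _ = zero , here
nonempty-of-suc (outside ∷ p) eq with nonempty-of-suc p eq
... | v , v∈p = suc v , there v∈p

∣p∣≡1+∣p-x∣ : (p : Subset n) → x ∈ p → ∣ p ∣ ≡ suc ∣ p - x ∣
∣p∣≡1+∣p-x∣ (inside ∷ p) here = cong (suc ∘ ∣_∣) (sym (p─⊥≡p p))
∣p∣≡1+∣p-x∣ (inside ∷ p) (there m) = cong suc (∣p∣≡1+∣p-x∣ p m)
∣p∣≡1+∣p-x∣ (outside ∷ p) (there m) = ∣p∣≡1+∣p-x∣ p m

∣p∣≡1+k⇒∣p-x∣≡k : x ∈ p → ∣ p ∣ ≡ suc k → ∣ p - x ∣ ≡ k
∣p∣≡1+k⇒∣p-x∣≡k {p = p} x∈p eq = suc-injective (trans (sym (∣p∣≡1+∣p-x∣ p x∈p)) eq)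

∣p∣≡0⇒x∉p : ∣ p ∣ ≡ 0 → x ∉ p
∣p∣≡0⇒x∉p {p = p} eq x∈p with trans (sym eq) (∣p∣≡1+∣p-x∣ p x∈p)
... | ()

x∉p-x : (p : Subset n) (x : Fin n) → x ∉ p - x
x∉p-x (s ∷ p) zero ()
x∉p-x (s ∷ p) (suc x) (there m) = x∉p-x p x m

2≤∣p∣ : u ∈ p → v ∈ p → u ≢ v → 2 ≤ ∣ p ∣
2≤∣p∣ {u = u} {p = p} u∈p v∈p u≢v
  rewrite ∣p∣≡1+∣p-x∣ p u∈p | ∣p∣≡1+∣p-x∣ (p - u) (x∈p∧x≢y⇒x∈p-y v∈p (u≢v ∘ sym)) =
  s≤s (s≤s z≤n)

triangle-elements : ∣ S ∣ ≡ 3 → u ∈ S → v ∈ S → w ∈ S → u ≢ v → u ≢ w → v ≢ w →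
  x ∈ S → x ≡ u ⊎ x ≡ v ⊎ x ≡ w
triangle-elements {S = S} {u} {v} {w} {x} ∣S∣≡3 u∈S v∈S w∈S u≢v u≢w v≢w x∈S
  with x ≟ u | x ≟ v | x ≟ w
... | yes x≡u | _ | _ = inj₁ x≡u
... | no _ | yes x≡v | _ = inj₂ (inj₁ x≡v)
... | no _ | no _ | yes x≡w = inj₂ (inj₂ x≡w)
... | no x≢u | no x≢v | no x≢w = ⊥-elim (∣p∣≡0⇒x∉p ∣S-u-v-w∣≡0 x∈S-u-v-w)
  where
  v∈S-u = x∈p∧x≢y⇒x∈p-y v∈S (u≢v ∘ sym)
  w∈S-u-v = x∈p∧x≢y⇒x∈p-y (x∈p∧x≢y⇒x∈p-y w∈S (u≢w ∘ sym)) (v≢w ∘ sym)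
  x∈S-u-v-w = x∈p∧x≢y⇒x∈p-y (x∈p∧x≢y⇒x∈p-y (x∈p∧x≢y⇒x∈p-y x∈S x≢u) x≢v) x≢w
  ∣S-u-v-w∣≡0 : ∣ S - u - v - w ∣ ≡ 0
  ∣S-u-v-w∣≡0 = ∣p∣≡1+k⇒∣p-x∣≡k w∈S-u-v (∣p∣≡1+k⇒∣p-x∣≡k v∈S-u (∣p∣≡1+k⇒∣p-x∣≡k u∈S ∣S∣≡3))

triangle-⊆ : ∣ S ∣ ≡ 3 → u ∈ S → v ∈ S → w ∈ S → u ≢ v → u ≢ w → v ≢ w →
  u ∈ R → v ∈ R → w ∈ R → S ⊆ R
triangle-⊆ ∣S∣≡3 u∈S v∈S w∈S u≢v u≢w v≢w u∈R v∈R w∈R x∈S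
  with triangle-elements ∣S∣≡3 u∈S v∈S w∈S u≢v u≢w v≢w x∈S
... | inj₁ refl = u∈R
... | inj₂ (inj₁ refl) = v∈R
... | inj₂ (inj₂ refl) = w∈R

triangle-≡ : ∣ S ∣ ≡ 3 → ∣ R ∣ ≡ 3 → u ∈ S → v ∈ S → w ∈ S → u ≢ v → u ≢ w → v ≢ w →
  u ∈ R → v ∈ R → w ∈ R → S ≡ R
triangle-≡ ∣S∣≡3 ∣R∣≡3 u∈S v∈S w∈S u≢v u≢w v≢w u∈R v∈R w∈R = ⊆-antisym
  (triangle-⊆ ∣S∣≡3 u∈S v∈S w∈S u≢v u≢w v≢w u∈R v∈R w∈R)
  (triangle-⊆ ∣R∣≡3 u∈R v∈R w∈R u≢v u≢w v≢w u∈S v∈S w∈S)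

triangle-third-unique : ∣ R ∣ ≡ 3 → u ∈ R → v ∈ R → u ≢ v →
  w ∈ R → x ∈ R → w ≢ u → w ≢ v → x ≢ u → x ≢ v → w ≡ x
triangle-third-unique ∣R∣≡3 u∈R v∈R u≢v w∈R x∈R w≢u w≢v x≢u x≢v
  with triangle-elements ∣R∣≡3 u∈R v∈R w∈R u≢v (w≢u ∘ sym) (w≢v ∘ sym) x∈R
... | inj₁ x≡u = ⊥-elim (x≢u x≡u)
... | inj₂ (inj₁ x≡v) = ⊥-elim (x≢v x≡v)
... | inj₂ (inj₂ x≡w) = sym x≡w

record OtherVertices (S : Subset n) (x : Fin n) : Set where
  field
    a b : Fin n
    a∈S : a ∈ S
    b∈S : b ∈ S
    a≢x : a ≢ x
    b≢x : b ≢ x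
    a≢b : a ≢ b

other-vertices : ∣ S ∣ ≡ 3 → x ∈ S → OtherVertices S x
other-vertices {S = S} {x} ∣S∣≡3 x∈S with nonempty-of-suc (S - x) ∣S-x∣≡2
  where ∣S-x∣≡2 = ∣p∣≡1+k⇒∣p-x∣≡k x∈S ∣S∣≡3
... | a , a∈S-x with nonempty-of-suc (S - x - a) (∣p∣≡1+k⇒∣p-x∣≡k a∈S-x (∣p∣≡1+k⇒∣p-x∣≡k x∈S ∣S∣≡3))
... | b , b∈S-x-a = record
  { a = a ; b = b
  ; a∈S = p─q⊆p S ⁅ x ⁆ a∈S-x
  ; b∈S = p─q⊆p S ⁅ x ⁆ b∈S-x
  ; a≢x = λ { refl → x∉p-x S a a∈S-x }
  ; b≢x = λ { refl → x∉p-x S b b∈S-x }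
  ; a≢b = λ { refl → x∉p-x (S - x) a b∈S-x-a }
  }
  where b∈S-x = p─q⊆p (S - x) ⁅ a ⁆ b∈S-x-a

edge : Fin n → Fin n → Subset n
edge x v = ⁅ x ⁆ ∪ ⁅ v ⁆

x∈edge : x ∈ edge x v
x∈edge {x = x} = x∈p∪q⁺ (inj₁ (x∈⁅x⁆ x))

v∈edge : v ∈ edge x v
v∈edge {v = v} = x∈p∪q⁺ (inj₂ (x∈⁅x⁆ v))

∈edge⁻ : u ∈ edge x v → u ≡ x ⊎ u ≡ v
∈edge⁻ {x = x} {v} m with x∈p∪q⁻ ⁅ x ⁆ ⁅ v ⁆ m
... | inj₁ u∈⁅x⁆ = inj₁ (x∈⁅y⁆⇒x≡y x u∈⁅x⁆)
... | inj₂ u∈⁅v⁆ = inj₂ (x∈⁅y⁆⇒x≡y v u∈⁅v⁆)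

edge⊆ : x ∈ S → v ∈ S → edge x v ⊆ S
edge⊆ x∈S v∈S m with ∈edge⁻ m
... | inj₁ refl = x∈S
... | inj₂ refl = v∈S

∈edge∧≢⇒≡ : u ∈ edge x v → u ≢ x → u ≡ v
∈edge∧≢⇒≡ u∈edge u≢x with ∈edge⁻ u∈edge
... | inj₁ u≡x = ⊥-elim (u≢x u≡x)
... | inj₂ u≡v = u≡v

edge-injectiveʳ : v ≢ x → edge x v ≡ edge x w → v ≡ w
edge-injectiveʳ v≢x eq = ∈edge∧≢⇒≡ (subst (_ ∈_) eq v∈edge) v≢x

triangle≢edge : ∣ S ∣ ≡ 3 → x ∈ S → S ≢ edge x v
triangle≢edge ∣S∣≡3 x∈S S≡edge =
  a≢b (trans (∈edge∧≢⇒≡ (subst (a ∈_) S≡edge a∈S) a≢x) (sym (∈edge∧≢⇒≡ (subst (b ∈_) S≡edge b∈S) b≢x)))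
  where open OtherVertices (other-vertices ∣S∣≡3 x∈S)

dangles? : (τ T : Subset n) (x : Fin n) → Dec (DanglesAt τ T x)
dangles? τ T x = Vec.≡-dec Bool._≟_ (τ ∩ T) ⁅ x ⁆

dangles⇒∈ : DanglesAt τ T x → x ∈ τ
dangles⇒∈ {x = x} d = ∈-∩ˡ (subst (x ∈_) (sym d) (x∈⁅x⁆ x))

dangles⇒≡ : DanglesAt τ T x → v ∈ τ → v ∈ T → v ≡ x
dangles⇒≡ {x = x} d v∈τ v∈T = x∈⁅y⁆⇒x≡y x (subst (_ ∈_) d (∈-∩⁺ v∈τ v∈T))

¬dangles⇒other-common : v ∈ τ → v ∈ T → ¬ DanglesAt τ T x → ∃ λ w → w ∈ τ × w ∈ T × w ≢ x
¬dangles⇒other-common {v = v} {τ} {T} {x} v∈τ v∈T ¬d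
  with any? (λ w → (w ∈? τ ×-dec w ∈? T) ×-dec ¬? (w ≟ x))
... | yes (w , (w∈τ , w∈T) , w≢x) = w , w∈τ , w∈T , w≢x
... | no ∄other = ⊥-elim (¬d (⊆-antisym ⊆⁅x⁆ ⁅x⁆⊆))
  where
  only-x : u ∈ τ ∩ T → u ≡ x
  only-x {u = u} m = decidable-stable (u ≟ x) λ u≢x → ∄other (u , (∈-∩ˡ m , ∈-∩ʳ m) , u≢x)
  ⊆⁅x⁆ : τ ∩ T ⊆ ⁅ x ⁆
  ⊆⁅x⁆ m = subst (_∈ ⁅ x ⁆) (sym (only-x m)) (x∈⁅x⁆ x)
  ⁅x⁆⊆ : ⁅ x ⁆ ⊆ τ ∩ T
  ⁅x⁆⊆ m = subst (_∈ τ ∩ T) (trans (only-x v∈τ∩T) (sym (x∈⁅y⁆⇒x≡y x m))) v∈τ∩T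
    where v∈τ∩T = ∈-∩⁺ v∈τ v∈T

module _ {a} {A : Set a} where

  length-≤-filter+∁filter : ∀ {p} {P : Pred A p} (P? : Decidable P) (xs : List A) →
    length xs ≤ length (filter P? xs) + length (filter (∁? P?) xs)
  length-≤-filter+∁filter P? [] = z≤n
  length-≤-filter+∁filter P? (x ∷ xs) with P? x
  ... | yes _ = s≤s (length-≤-filter+∁filter P? xs)
  ... | no _ rewrite +-suc (length (filter P? xs)) (length (filter (∁? P?) xs)) =
    s≤s (length-≤-filter+∁filter P? xs)

  length≤1⊎two-distinct : (xs : List A) → Unique xs →
    length xs ≤ 1 ⊎ ∃₂ λ u v → u List.∈ xs × v List.∈ xs × u ≢ v
  length≤1⊎two-distinct [] _ = inj₁ z≤n
  length≤1⊎two-distinct (u ∷ []) _ = inj₁ (s≤s z≤n)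
  length≤1⊎two-distinct (u ∷ v ∷ _) ((u≢v ∷ _) ∷ _) = inj₂ (u , v , here refl , there (here refl) , u≢v)

  Unique-map⁺-on : ∀ {b} {B : Set b} (f : A → B) {xs : List A} →
    (∀ {u v} → u List.∈ xs → v List.∈ xs → f u ≡ f v → u ≡ v) → Unique xs → Unique (map f xs)
  Unique-map⁺-on f {[]} _ _ = []
  Unique-map⁺-on f {x ∷ xs} inj (x∉xs ∷ xs!) =
    map⁺ (tabulate λ y∈xs fx≡fy → lookup x∉xs y∈xs (inj (here refl) (there y∈xs) fx≡fy))
    ∷ Unique-map⁺-on f (λ u∈ v∈ → inj (there u∈) (there v∈)) xs!

common-element : {F : Family n} → Intersecting F → S ∈F F → T ∈F F → ∃ λ v → v ∈ S × v ∈ T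
common-element int S∈F T∈F with int _ _ S∈F T∈F
... | v , m = v , ∈-∩ˡ m , ∈-∩ʳ m

common-vertex⇒Intersecting : (F : Family n) → (∀ A → A ∈F F → x ∈ A) → Intersecting F
common-vertex⇒Intersecting {x = x} F ∋x A B A∈F B∈F = x , ∈-∩⁺ (∋x A A∈F) (∋x B B∈F)

Improvement : Family n → Set
Improvement {n} F = Σ (Family n) λ F' → IsSetFamily F' × SubfamilyOfComplex F' F × Intersecting F' ×
  length F ≤ length F' × Σ _ λ A → A ∈F F' × (∣ A ∣ ≡ 2 ⊎ ∣ A ∣ ≡ 1)

danglersOf : Family n → Subset n → Fin n → Family n
danglersOf F T x = filter (λ τ → dangles? τ T x) F

data Danglers (F : Family n) (T : Subset n) (x : Fin n) : Set where
  atMostOne : length (danglersOf F T x) ≤ 1 → Danglers F T x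
  twoDistinct : ∀ {τ₁ τ₂} → τ₁ ∈F F → τ₂ ∈F F → DanglesAt τ₁ T x → DanglesAt τ₂ T x → τ₁ ≢ τ₂ →
    Danglers F T x

danglers : (F : Family n) → IsSetFamily F → ∀ T x → Danglers F T x
danglers F F-set T x
  with length≤1⊎two-distinct (danglersOf F T x) (Unique.filter⁺ (λ τ → dangles? τ T x) F-set)
... | inj₁ ≤1 = atMostOne ≤1
... | inj₂ (τ₁ , τ₂ , τ₁∈ , τ₂∈ , τ₁≢τ₂) =
  twoDistinct (proj₁ τ₁-dangler) (proj₁ τ₂-dangler) (proj₂ τ₁-dangler) (proj₂ τ₂-dangler) τ₁≢τ₂
  where
  τ₁-dangler = ∈-filter⁻ (λ τ → dangles? τ T x) {xs = F} τ₁∈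
  τ₂-dangler = ∈-filter⁻ (λ τ → dangles? τ T x) {xs = F} τ₂∈

module FewDanglers {n} {F : Family n} (F-set : IsSetFamily F) (tri : AllTriangles F)
  (int : Intersecting F) {T : Subset n} (T∈F : T ∈F F) {x : Fin n} (x∈T : x ∈ T)
  (few : length (danglersOf F T x) ≤ 1) where

  nondangling? : Decidable (∁ λ S → DanglesAt S T x)
  nondangling? = ∁? (λ S → dangles? S T x)

  ∈nondanglers⁻ : S List.∈ filter nondangling? F → S ∈F F × ¬ DanglesAt S T x
  ∈nondanglers⁻ = ∈-filter⁻ nondangling? {xs = F}

  e : Subset n
  e = T - x

  ∣e∣≡2 : ∣ e ∣ ≡ 2
  ∣e∣≡2 = ∣p∣≡1+k⇒∣p-x∣≡k x∈T (tri T T∈F)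

  e-meets : S ∈F F → ¬ DanglesAt S T x → ∃ λ v → v ∈ e × v ∈ S
  e-meets S∈F ¬d with common-element int S∈F T∈F
  ... | v , v∈S , v∈T with ¬dangles⇒other-common v∈S v∈T ¬d
  ... | w , w∈S , w∈T , w≢x = w , x∈p∧x≢y⇒x∈p-y w∈T w≢x , w∈S

  F' : Family n
  F' = e ∷ filter nondangling? F

  F'-set : IsSetFamily F'
  F'-set = tabulate e≢S ∷ Unique.filter⁺ nondangling? F-set
    where
    e≢S : S List.∈ filter nondangling? F → e ≢ S
    e≢S S∈ e≡S with trans (sym ∣e∣≡2) (trans (cong ∣_∣ e≡S) (tri _ (proj₁ (∈nondanglers⁻ S∈))))
    ... | ()

  F'⊆C : SubfamilyOfComplex F' F
  F'⊆C _ (here refl) = T , T∈F , p─q⊆p T ⁅ x ⁆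
  F'⊆C A (there A∈) = A , proj₁ (∈nondanglers⁻ A∈) , λ m → m

  F'-intersecting : Intersecting F'
  F'-intersecting _ _ (here refl) (here refl) with nonempty-of-suc e ∣e∣≡2
  ... | v , v∈e = v , ∈-∩⁺ v∈e v∈e
  F'-intersecting _ B (here refl) (there B∈) with uncurry e-meets (∈nondanglers⁻ B∈)
  ... | v , v∈e , v∈B = v , ∈-∩⁺ v∈e v∈B
  F'-intersecting A _ (there A∈) (here refl) with uncurry e-meets (∈nondanglers⁻ A∈)
  ... | v , v∈e , v∈A = v , ∈-∩⁺ v∈A v∈e
  F'-intersecting A B (there A∈) (there B∈) =
    int A B (proj₁ (∈nondanglers⁻ A∈)) (proj₁ (∈nondanglers⁻ B∈))

  improvement : Improvement F
  improvement = F' , F'-set , F'⊆C , F'-intersecting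
    , ≤-trans (length-≤-filter+∁filter (λ S → dangles? S T x) F) (+-monoˡ-≤ _ few)
    , e , here refl , inj₁ ∣e∣≡2

module Linear {n} {F : Family n} (F-set : IsSetFamily F) (tri : AllTriangles F) (int : Intersecting F)
  (linear : Cond2 F) {T τ : Subset n} (T∈F : T ∈F F) (τ∈F : τ ∈F F) {x : Fin n} (x∈T : x ∈ T)
  (τ-dangles : DanglesAt τ T x) where

  x∈τ : x ∈ τ
  x∈τ = dangles⇒∈ τ-dangles

  open OtherVertices (other-vertices (tri T T∈F) x∈T)
    renaming (a to a₁; b to a₂; a∈S to a₁∈T; b∈S to a₂∈T; a≢x to a₁≢x; b≢x to a₂≢x; a≢b to a₁≢a₂)
  open OtherVertices (other-vertices (tri τ τ∈F) x∈τ)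
    renaming (a to b₁; b to b₂; a∈S to b₁∈τ; b∈S to b₂∈τ; a≢x to b₁≢x; b≢x to b₂≢x; a≢b to b₁≢b₂)

  a : Bool → Fin n
  a i = if i then a₁ else a₂

  b : Bool → Fin n
  b j = if j then b₁ else b₂

  a-spec : ∀ i → a i ∈ T × a i ≢ x
  a-spec true = a₁∈T , a₁≢x
  a-spec false = a₂∈T , a₂≢x

  b-spec : ∀ j → b j ∈ τ × b j ≢ x
  b-spec true = b₁∈τ , b₁≢x
  b-spec false = b₂∈τ , b₂≢x

  a≢b : ∀ i j → a i ≢ b j
  a≢b i j a≡b = proj₂ (a-spec i)
    (dangles⇒≡ τ-dangles (subst (_∈ τ) (sym a≡b) (proj₁ (b-spec j))) (proj₁ (a-spec i)))

  α β : Subset n → Fin n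
  α S = a (does (a₁ ∈? S))
  β S = b (does (b₁ ∈? S))

  α∈ : S ∈F F → x ∉ S → α S ∈ S
  α∈ {S} S∈F x∉S with a₁ ∈? S
  ... | yes a₁∈S = a₁∈S
  ... | no a₁∉S with common-element int S∈F T∈F
  ... | w , w∈S , w∈T = subst (_∈ S)
    (triangle-third-unique (tri T T∈F) x∈T a₁∈T (a₁≢x ∘ sym) w∈T a₂∈T
      (∈∧∉⇒≢ w∈S x∉S) (∈∧∉⇒≢ w∈S a₁∉S) a₂≢x (a₁≢a₂ ∘ sym))
    w∈S

  β∈ : S ∈F F → x ∉ S → β S ∈ S
  β∈ {S} S∈F x∉S with b₁ ∈? S
  ... | yes b₁∈S = b₁∈S
  ... | no b₁∉S with common-element int S∈F τ∈F
  ... | w , w∈S , w∈τ = subst (_∈ S)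
    (triangle-third-unique (tri τ τ∈F) x∈τ b₁∈τ (b₁≢x ∘ sym) w∈τ b₂∈τ
      (∈∧∉⇒≢ w∈S x∉S) (∈∧∉⇒≢ w∈S b₁∉S) b₂≢x (b₁≢b₂ ∘ sym))
    w∈S

  code : Bool → Bool → Fin n
  code i j = if i then a j else b j

  code≢x : ∀ i j → code i j ≢ x
  code≢x true j = proj₂ (a-spec j)
  code≢x false j = proj₂ (b-spec j)

  code-edge : ∀ i j → ∃ λ R → R ∈F F × x ∈ R × code i j ∈ R
  code-edge true j = T , T∈F , x∈T , proj₁ (a-spec j)
  code-edge false j = τ , τ∈F , x∈τ , proj₁ (b-spec j)

  code-injective : ∀ {i j i′ j′} → code i j ≡ code i′ j′ → i ≡ i′ × j ≡ j′
  code-injective {true} {_} {true} eq = refl , if-injective a₁≢a₂ eq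
  code-injective {true} {j} {false} {j′} eq = ⊥-elim (a≢b j j′ eq)
  code-injective {false} {j} {true} {j′} eq = ⊥-elim (a≢b j′ j (sym eq))
  code-injective {false} {_} {false} eq = refl , if-injective b₁≢b₂ eq

  label : Subset n → Fin n
  label S = code (does (a₁ ∈? S)) (does (b₁ ∈? S))

  label≢x : ∀ S → label S ≢ x
  label≢x S = code≢x (does (a₁ ∈? S)) (does (b₁ ∈? S))

  label-injective : ∀ {S₁ S₂} → S₁ ∈F F → S₂ ∈F F → x ∉ S₁ → x ∉ S₂ → label S₁ ≡ label S₂ → S₁ ≡ S₂
  label-injective {S₁} {S₂} S₁∈F S₂∈F x∉S₁ x∉S₂ eq with code-injective eq
  ... | i≡ , j≡ = linear S₁ S₂ S₁∈F S₂∈F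
    (2≤∣p∣ (∈-∩⁺ (α∈ S₁∈F x∉S₁) α∈S₂) (∈-∩⁺ (β∈ S₁∈F x∉S₁) β∈S₂) (a≢b _ _))
    where
    α∈S₂ : α S₁ ∈ S₂
    α∈S₂ = subst (_∈ S₂) (cong a (sym i≡)) (α∈ S₂∈F x∉S₂)
    β∈S₂ : β S₁ ∈ S₂
    β∈S₂ = subst (_∈ S₂) (cong b (sym j≡)) (β∈ S₂∈F x∉S₂)

  anchor : Subset n → Subset n
  anchor S with x ∈? S
  ... | yes _ = S
  ... | no _ = edge x (label S)

  x∈anchor : ∀ S → x ∈ anchor S
  x∈anchor S with x ∈? S
  ... | yes x∈S = x∈S
  ... | no _ = x∈edge

  anchor-∈C : S ∈F F → anchor S ∈C F
  anchor-∈C {S} S∈F with x ∈? S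
  ... | yes _ = S , S∈F , λ m → m
  ... | no _ with code-edge (does (a₁ ∈? S)) (does (b₁ ∈? S))
  ... | R , R∈F , x∈R , c∈R = R , R∈F , edge⊆ x∈R c∈R

  anchor≢⁅x⁆ : S ∈F F → anchor S ≢ ⁅ x ⁆
  anchor≢⁅x⁆ {S} S∈F with x ∈? S
  ... | yes _ = λ S≡⁅x⁆ → 3≢1 (trans (sym (tri S S∈F)) (trans (cong ∣_∣ S≡⁅x⁆) (∣⁅x⁆∣≡1 x)))
    where
    3≢1 : 3 ≢ 1
    3≢1 ()
  ... | no _ = λ eq → label≢x S (x∈⁅y⁆⇒x≡y x (subst (label S ∈_) eq v∈edge))

  anchor-injective : ∀ {S₁ S₂} → S₁ ∈F F → S₂ ∈F F → anchor S₁ ≡ anchor S₂ → S₁ ≡ S₂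
  anchor-injective {S₁} {S₂} S₁∈F S₂∈F with x ∈? S₁ | x ∈? S₂
  ... | yes _ | yes _ = λ eq → eq
  ... | yes x∈S₁ | no _ = ⊥-elim ∘ triangle≢edge (tri S₁ S₁∈F) x∈S₁
  ... | no _ | yes x∈S₂ = ⊥-elim ∘ triangle≢edge (tri S₂ S₂∈F) x∈S₂ ∘ sym
  ... | no x∉S₁ | no x∉S₂ =
    label-injective S₁∈F S₂∈F x∉S₁ x∉S₂ ∘ edge-injectiveʳ (label≢x S₁)

  F' : Family n
  F' = ⁅ x ⁆ ∷ map anchor F

  F'-set : IsSetFamily F'
  F'-set = map⁺ (tabulate λ S∈F → anchor≢⁅x⁆ S∈F ∘ sym) ∷ Unique-map⁺-on anchor anchor-injective F-set

  F'∋x : ∀ A → A ∈F F' → x ∈ A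
  F'∋x _ (here refl) = x∈⁅x⁆ x
  F'∋x _ (there A∈) with ∈-map⁻ anchor A∈
  ... | S , _ , refl = x∈anchor S

  F'⊆C : SubfamilyOfComplex F' F
  F'⊆C _ (here refl) = T , T∈F , λ m → subst (_∈ T) (sym (x∈⁅y⁆⇒x≡y x m)) x∈T
  F'⊆C _ (there A∈) with ∈-map⁻ anchor A∈
  ... | _ , S∈F , refl = anchor-∈C S∈F

  improvement : Improvement F
  improvement = F' , F'-set , F'⊆C , common-vertex⇒Intersecting F' F'∋x
    , ≤-trans (≤-reflexive (sym (length-map anchor F))) (n≤1+n _)
    , ⁅ x ⁆ , here refl , inj₂ (∣⁅x⁆∣≡1 x)

module NoCommonTriangle {n} {F : Family n} (tri : AllTriangles F) (int : Intersecting F) {x y : Fin n}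
  (apart : ¬ (∃ λ R → R ∈F F × x ∈ R × y ∈ R))
  {T W : Subset n} (T∈F : T ∈F F) (x∈T : x ∈ T) (W∈F : W ∈F F) (y∈W : y ∈ W)
  {τ₁ τ₂ σ : Subset n} (τ₁∈F : τ₁ ∈F F) (τ₂∈F : τ₂ ∈F F)
  (τ₁-dangles : DanglesAt τ₁ T x) (τ₂-dangles : DanglesAt τ₂ T x) (τ₁≢τ₂ : τ₁ ≢ τ₂)
  (σ∈F : σ ∈F F) (σ-dangles : DanglesAt σ W y) where

  y∉ : R ∈F F → x ∈ R → y ∉ R
  y∉ R∈F x∈R y∈R = apart (_ , R∈F , x∈R , y∈R)

  y∉T : y ∉ T
  y∉T = y∉ T∈F x∈T

  x∉W : x ∉ W
  x∉W x∈W = y∉ W∈F x∈W y∈W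

  x∉σ : x ∉ σ
  x∉σ x∈σ = y∉ σ∈F x∈σ (dangles⇒∈ σ-dangles)

  y∉dangler : τ ∈F F → DanglesAt τ T x → y ∉ τ
  y∉dangler τ∈F d = y∉ τ∈F (dangles⇒∈ d)

  meets-W-outside-T : τ ∈F F → DanglesAt τ T x → ∃ λ w → w ∈ τ × w ∈ W × w ∉ T
  meets-W-outside-T τ∈F d with common-element int τ∈F W∈F
  ... | w , w∈τ , w∈W = w , w∈τ , w∈W , λ w∈T → x∉W (subst (_∈ W) (dangles⇒≡ d w∈τ w∈T) w∈W)

  meets-σ-outside-T∪W : τ ∈F F → DanglesAt τ T x → ∃ λ p → p ∈ τ × p ∈ σ × p ∉ T × p ∉ W
  meets-σ-outside-T∪W τ∈F d with common-element int τ∈F σ∈F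
  ... | p , p∈τ , p∈σ = p , p∈τ , p∈σ
    , (λ p∈T → x∉σ (subst (_∈ σ) (dangles⇒≡ d p∈τ p∈T) p∈σ))
    , (λ p∈W → y∉dangler τ∈F d (subst (_∈ _) (dangles⇒≡ σ-dangles p∈σ p∈W) p∈τ))

  -- σ = {y, t, p₁} and W = {y, z, w₁}, with t, z ∈ T, force p₂ = p₁ and w₂ = w₁, hence τ₁ = τ₂.
  absurd : ⊥
  absurd
    with meets-W-outside-T τ₁∈F τ₁-dangles | meets-W-outside-T τ₂∈F τ₂-dangles
       | meets-σ-outside-T∪W τ₁∈F τ₁-dangles | meets-σ-outside-T∪W τ₂∈F τ₂-dangles
       | common-element int σ∈F T∈F | common-element int W∈F T∈F
  ... | w₁ , w₁∈τ₁ , w₁∈W , w₁∉T | w₂ , w₂∈τ₂ , w₂∈W , w₂∉T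
      | p₁ , p₁∈τ₁ , p₁∈σ , p₁∉T , p₁∉W | p₂ , p₂∈τ₂ , p₂∈σ , p₂∉T , p₂∉W
      | t , t∈σ , t∈T | z , z∈W , z∈T =
    τ₁≢τ₂ (triangle-≡ (tri τ₁ τ₁∈F) (tri τ₂ τ₂∈F)
      (dangles⇒∈ τ₁-dangles) w₁∈τ₁ p₁∈τ₁
      (∈∧∉⇒≢ w₁∈W x∉W ∘ sym) (∈∧∉⇒≢ x∈T p₁∉T) (∈∧∉⇒≢ w₁∈W p₁∉W)
      (dangles⇒∈ τ₂-dangles) (subst (_∈ τ₂) w₂≡w₁ w₂∈τ₂) (subst (_∈ τ₂) p₂≡p₁ p₂∈τ₂))
    where
    w₂≡w₁ : w₂ ≡ w₁
    w₂≡w₁ = triangle-third-unique (tri W W∈F) y∈W z∈W (∈∧∉⇒≢ z∈T y∉T ∘ sym) w₂∈W w₁∈W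
      (∈∧∉⇒≢ w₂∈τ₂ (y∉dangler τ₂∈F τ₂-dangles)) (∈∧∉⇒≢ z∈T w₂∉T ∘ sym)
      (∈∧∉⇒≢ w₁∈τ₁ (y∉dangler τ₁∈F τ₁-dangles)) (∈∧∉⇒≢ z∈T w₁∉T ∘ sym)
    p₂≡p₁ : p₂ ≡ p₁
    p₂≡p₁ = triangle-third-unique (tri σ σ∈F) (dangles⇒∈ σ-dangles) t∈σ (∈∧∉⇒≢ t∈T y∉T ∘ sym)
      p₂∈σ p₁∈σ (∈∧∉⇒≢ y∈W p₂∉W ∘ sym) (∈∧∉⇒≢ t∈T p₂∉T ∘ sym)
      (∈∧∉⇒≢ y∈W p₁∉W ∘ sym) (∈∧∉⇒≢ t∈T p₁∉T ∘ sym)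

lemma3p1 : ∀ n (F : Family n) → IsSetFamily F → F ≢ [] → AllTriangles F → Intersecting F →
    Cond1 F ⊎ Cond2 F ⊎ Cond3 F →
    Σ (Family n) λ F' → IsSetFamily F' × SubfamilyOfComplex F' F × Intersecting F' ×
      length F ≤ length F' × Σ _ λ A → A ∈F F' × (∣ A ∣ ≡ 2 ⊎ ∣ A ∣ ≡ 1)
lemma3p1 n F F-set _ tri int (inj₁ (T , T∈F , x , x∈T , dangler-unique)) with danglers F F-set T x
... | atMostOne few = FewDanglers.improvement F-set tri int T∈F x∈T few
... | twoDistinct τ₁∈F τ₂∈F τ₁-d τ₂-d τ₁≢τ₂ = ⊥-elim (τ₁≢τ₂ (dangler-unique _ _ τ₁∈F τ₂∈F τ₁-d τ₂-d))
lemma3p1 n [] _ []≢[] _ _ (inj₂ (inj₁ _)) = ⊥-elim ([]≢[] refl)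
lemma3p1 n F@(T ∷ _) F-set _ tri int (inj₂ (inj₁ linear)) with nonempty-of-suc T (tri T (here refl))
... | x , x∈T with danglers F F-set T x
... | atMostOne few = FewDanglers.improvement F-set tri int (here refl) x∈T few
... | twoDistinct τ∈F _ τ-d _ _ = Linear.improvement F-set tri int linear (here refl) τ∈F x∈T τ-d
lemma3p1 n F F-set _ tri int (inj₂ (inj₂ (x , y , _ , (T , T∈F , x∈T) , (W , W∈F , y∈W) , apart)))
  with danglers F F-set T x | danglers F F-set W y
... | atMostOne few | _ = FewDanglers.improvement F-set tri int T∈F x∈T few
... | _ | atMostOne few = FewDanglers.improvement F-set tri int W∈F y∈W few
... | twoDistinct τ₁∈F τ₂∈F τ₁-d τ₂-d τ₁≢τ₂ | twoDistinct σ∈F _ σ-d _ _ =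
  ⊥-elim (NoCommonTriangle.absurd tri int apart T∈F x∈T W∈F y∈W τ₁∈F τ₂∈F τ₁-d τ₂-d τ₁≢τ₂ σ∈F σ-d)
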